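{- Let $G$ be a $d$-degenerate graph, let $k\ge d+2$, and let $\sigma,\eta$ be two proper $k$-colorings of $G$. Assume that $G$ has a degeneracy ordering (an ordering in which every vertex has at most $d$ neighbors appearing after it) that is the concatenation of $t$ consecutive independent sets. Then there is a recoloring sequence from $\sigma$ to $\eta$ (through proper $k$-colorings) given by a restricted schedule of length at most $k^{t+1}$.
   Context: A graph is $d$-degenerate if every subgraph has a vertex of degree at most $d$. A restricted schedule of length $\ell$ is a sequence of proper colorings $c_0=\sigma,\dots,c_\ell=\eta$ such that for each step there are colors $a\ne b$ with every vertex whose color changes at that step going from $a$ to $b$. -}

module Defs where

open import Data.Nat using (ℕ; zero; suc; _≤_)
open import Data.Bool using (Bool; true; false; if_then_else_)
open import Data.Fin using (Fin; _<_; inject₁; fromℕ)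
import Data.Fin as F
open import Data.Fin.Subset using (Subset; _∈_; Nonempty)
open import Data.Product using (Σ; ∃; _×_; _,_)
open import Data.Vec.Functional using (Vector)
open import Relation.Binary.PropositionalEquality using (_≡_; _≢_)
open import Function.Bundles using (_↔_)

record Graph (n : ℕ) : Set where
  field
    adj     : Fin n → Fin n → Bool
    symm    : ∀ u v → adj u v ≡ adj v u
    irrefl  : ∀ v → adj v v ≡ false
open Graph public

count : ∀ {m} → (Fin m → Bool) → ℕ
count {zero}  p = 0
count {suc m} p = (if p F.zero then 1 else 0) Data.Nat.+ count (λ i → p (F.suc i))
  where import Data.Nat

_∧_ : Bool → Bool → Bool
true ∧ b = b
false ∧ _ = false

degIn : ∀ {n} → Graph n → Subset n → Fin n → ℕ
degIn G S v = count (λ u → isIn u ∧ adj G v u)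
  where
    isIn : _ → Bool
    isIn u = Data.Vec.lookup S u
      where import Data.Vec

Degenerate : ∀ {n} → ℕ → Graph n → Set
Degenerate d G = ∀ S → Nonempty S → ∃ λ v → v ∈ S × degIn G S v ≤ d

-- A vertex ordering: ord i is the vertex at position i (a bijection).
-- Degeneracy ordering: every vertex has at most d neighbours appearing after it.
IsDegeneracyOrdering : ∀ {n} → ℕ → Graph n → (Fin n ↔ Fin n) → Set
IsDegeneracyOrdering d G ord =
  ∀ i → count (λ j → isLater i j ∧ adj G (at i) (at j)) ≤ d
  where
    open Function.Bundles.Inverse ord renaming (to to at)
    isLater : _ → _ → Bool
    isLater i j = Relation.Nullary.Decidable.Core.does (i F.<? j)
      where import Relation.Nullary.Decidable.Core

IsConcatOfIndependentSets : ∀ {n} → Graph n → (Fin n ↔ Fin n) → ℕ → Set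
IsConcatOfIndependentSets {n} G ord t =
  Σ (Fin n → Fin t) λ block →
    (∀ i j → i F.≤ j → block i F.≤ block j) ×
    (∀ i j → block i ≡ block j → adj G (at i) (at j) ≡ false)
  where open Function.Bundles.Inverse ord renaming (to to at)

Coloring : ℕ → ℕ → Set
Coloring n k = Fin n → Fin k

Proper : ∀ {n k} → Graph n → Coloring n k → Set
Proper G c = ∀ u v → adj G u v ≡ true → c u ≢ c v

RestrictedStep : ∀ {n k} → Coloring n k → Coloring n k → Set
RestrictedStep {n} {k} c c' =
  Σ (Fin k) λ a → Σ (Fin k) λ b → a ≢ b ×
    (∀ v → c v ≢ c' v → c v ≡ a × c' v ≡ b)

record RestrictedSchedule {n k} (G : Graph n) (σ η : Coloring n k) (ℓ : ℕ) : Set where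
  field
    col    : Fin (suc ℓ) → Coloring n k
    start  : ∀ v → col F.zero v ≡ σ v
    finish : ∀ v → col (fromℕ ℓ) v ≡ η v
    proper : ∀ i → Proper G (col i)
    step   : ∀ (i : Fin ℓ) → RestrictedStep (col (inject₁ i)) (col (F.suc i))

{-# OPTIONS --safe #-}
-- Recolour the independent blocks from the last one to the first. Suppose a
-- schedule takes σ to η on the blocks after block s, keeping those blocks
-- properly coloured. Lift it to block s: before each step a → b of that
-- schedule, move every vertex of block s coloured b to a colour ≠ b that none
-- of its later neighbours has. Block s is independent and each vertex has at
-- most d later neighbours, so k ≥ d + 2 colours leave such a colour, and one
-- restricted step per target colour (k − 1 steps) does the move. Each step
-- thus costs k steps, and a final k (k − 1) steps, one per colour pair, bring
-- block s to η. A schedule of length ℓ becomes one of length (ℓ + k) k − k,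
-- and the t blocks give length k^(t+1) − k.
module Submission where

open import Defs
open import Data.Nat using (ℕ; zero; suc; _≤_; _<_; _+_; _*_; _^_; z≤n; s≤s)
import Data.Nat as ℕ
import Data.Nat.Properties as ℕP
open import Data.Fin using (Fin; toℕ; punchIn; inject₁; fromℕ)
import Data.Fin as F
import Data.Fin.Properties as FP
open import Data.Bool using (Bool; true; false; if_then_else_)
open import Data.List
  using (List; []; _∷_; [_]; map; length; allFin; lookup; cartesianProductWith)
import Data.List.Properties as LP
open import Data.List.Membership.Propositional using (_∈_; _∉_)
import Data.List.Membership.Propositional.Properties as MP
open import Data.List.Relation.Unary.Any using (here; there; index)
open import Data.List.Relation.Unary.Any.Properties using (lookup-index)
open import Data.Product using (Σ; ∃; _×_; _,_; proj₁; proj₂)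
open import Data.Sum using (_⊎_; inj₁; inj₂)
open import Data.Empty using (⊥-elim)
open import Function.Bundles using (_↔_; Inverse)
open import Relation.Binary.PropositionalEquality
  using (_≡_; _≢_; refl; sym; trans; cong; cong₂; subst; module ≡-Reasoning)
open import Relation.Nullary using (Dec; yes; no; ¬_; does)
open import Relation.Nullary.Decidable using (dec-true; _×-dec_)

override : {X A : Set} {P : X → Set} → (∀ x → Dec (P x)) → (X → A) → (X → A) → X → A
override P? f g x = if does (P? x) then f x else g x

module _ {X A : Set} {P : X → Set} (P? : ∀ x → Dec (P x)) (f g : X → A) {x : X} where

  override-yes : P x → override P? f g x ≡ f x
  override-yes px with P? x
  ... | yes _ = refl
  ... | no ¬px = ⊥-elim (¬px px)

  override-no : ¬ P x → override P? f g x ≡ g x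
  override-no ¬px with P? x
  ... | yes px = ⊥-elim (¬px px)
  ... | no _ = refl

  override-changed : g x ≢ override P? f g x → P x
  override-changed g≢ with P? x
  ... | yes px = px
  ... | no _ = ⊥-elim (g≢ refl)

imageWhere : ∀ {m} {A : Set} → (Fin m → Bool) → (Fin m → A) → List A
imageWhere {zero} p f = []
imageWhere {suc m} p f = if p F.zero then f F.zero ∷ rest else rest
  where rest = imageWhere (λ i → p (F.suc i)) (λ i → f (F.suc i))

length-imageWhere : ∀ {m} {A : Set} (p : Fin m → Bool) (f : Fin m → A) →
  length (imageWhere p f) ≡ count p
length-imageWhere {zero} p f = refl
length-imageWhere {suc m} p f with p F.zero
... | true = cong suc (length-imageWhere (λ i → p (F.suc i)) (λ i → f (F.suc i)))
... | false = length-imageWhere (λ i → p (F.suc i)) (λ i → f (F.suc i))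

∈-imageWhere : ∀ {m} {A : Set} (p : Fin m → Bool) (f : Fin m → A) {j} →
  p j ≡ true → f j ∈ imageWhere p f
∈-imageWhere {suc m} p f {F.zero} pj rewrite pj = here refl
∈-imageWhere {suc m} p f {F.suc j} pj with p F.zero
... | true = there (∈-imageWhere (λ i → p (F.suc i)) (λ i → f (F.suc i)) pj)
... | false = ∈-imageWhere (λ i → p (F.suc i)) (λ i → f (F.suc i)) pj

∃∉-if-length< : ∀ {K} (xs : List (Fin K)) → length xs < K → ∃ λ x → x ∉ xs
∃∉-if-length< {K} xs |xs|<K = FP.¬∀⟶∃¬ K (_∈ xs) (_∈? xs) not-all-listed
  where
    open import Data.List.Membership.DecPropositional (FP._≟_ {K}) using (_∈?_)

    not-all-listed : ¬ (∀ x → x ∈ xs)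
    not-all-listed all∈ with FP.pigeonhole |xs|<K (λ x → index (all∈ x))
    ... | i , j , i<j , same-index = FP.<⇒≢ i<j (begin
      i                          ≡⟨ lookup-index (all∈ i) ⟩
      lookup xs (index (all∈ i)) ≡⟨ cong (lookup xs) same-index ⟩
      lookup xs (index (all∈ j)) ≡⟨ lookup-index (all∈ j) ⟨
      j                          ∎)
      where open ≡-Reasoning

fresh-colour : ∀ {m K d} (p : Fin m → Bool) (f : Fin m → Fin K) (b : Fin K) →
  count p ≤ d → d + 2 ≤ K → ∃ λ x → x ≢ b × (∀ j → p j ≡ true → f j ≢ x)
fresh-colour {K = K} {d} p f b count≤d d+2≤K =
  let x , x∉ = ∃∉-if-length< (b ∷ imageWhere p f) short in
  x , (λ x≡b → x∉ (here x≡b)) ,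
  λ j pj fj≡x → x∉ (there (subst (_∈ imageWhere p f) fj≡x (∈-imageWhere p f pj)))
  where
    short : suc (suc (length (imageWhere p f))) ≤ K
    short = ℕP.≤-trans (s≤s (s≤s (subst (_≤ d) (sym (length-imageWhere p f)) count≤d)))
                       (subst (_≤ K) (ℕP.+-comm d 2) d+2≤K)

data Schedule {n K : ℕ} (P : Coloring n K → Set) : Coloring n K → ℕ → Set where
  nil  : ∀ {c} → P c → Schedule P c 0
  cons : ∀ {c c' ℓ} → P c → RestrictedStep c c' → Schedule P c' ℓ → Schedule P c (suc ℓ)

module _ {n K : ℕ} where

  private variable
    ℓ ℓ' : ℕ
    P Q : Coloring n K → Set
    c : Coloring n K

  last : Schedule P c ℓ → Coloring n K
  last {c = c} (nil _) = c
  last (cons _ _ p) = last p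

  head-satisfies : Schedule P c ℓ → P c
  head-satisfies (nil pc) = pc
  head-satisfies (cons pc _ _) = pc

  last-satisfies : (p : Schedule P c ℓ) → P (last p)
  last-satisfies (nil pc) = pc
  last-satisfies (cons _ _ p) = last-satisfies p

  _++_ : (p : Schedule P c ℓ) → Schedule P (last p) ℓ' → Schedule P c (ℓ + ℓ')
  nil _ ++ q = q
  cons pc st p ++ q = cons pc st (p ++ q)

  last-++ : (p : Schedule P c ℓ) (q : Schedule P (last p) ℓ') → last (p ++ q) ≡ last q
  last-++ (nil _) q = refl
  last-++ (cons _ _ p) q = last-++ p q

  cast : ℓ ≡ ℓ' → Schedule P c ℓ → Schedule P c ℓ'
  cast refl p = p

  last-cast : (eq : ℓ ≡ ℓ') (p : Schedule P c ℓ) → last (cast eq p) ≡ last p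
  last-cast refl p = refl

  mapₛ : (∀ {c} → P c → Q c) → Schedule P c ℓ → Schedule Q c ℓ
  mapₛ f (nil pc) = nil (f pc)
  mapₛ f (cons pc st p) = cons (f pc) st (mapₛ f p)

  last-mapₛ : (f : ∀ {c} → P c → Q c) (p : Schedule P c ℓ) → last (mapₛ f p) ≡ last p
  last-mapₛ f (nil _) = refl
  last-mapₛ f (cons _ _ p) = last-mapₛ f p

  toRestrictedSchedule : (G : Graph n) → (∀ {c} → P c → Proper G c) → ∀ {σ η} →
    (p : Schedule P σ ℓ) → (∀ v → last p v ≡ η v) → RestrictedSchedule G σ η ℓ
  toRestrictedSchedule {P = P} G proper p p≗η = record
    { col = colourAt p
    ; start = λ _ → refl
    ; finish = λ v → trans (cong (λ c → c v) (colourAt-last p)) (p≗η v)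
    ; proper = λ i → proper (colourAt-satisfies p i)
    ; step = colourAt-step p
    }
    where
      colourAt : Schedule P c ℓ → Fin (suc ℓ) → Coloring n K
      colourAt {c = c} p F.zero = c
      colourAt (cons _ _ p) (F.suc i) = colourAt p i

      colourAt-last : (p : Schedule P c ℓ) → colourAt p (fromℕ ℓ) ≡ last p
      colourAt-last (nil _) = refl
      colourAt-last (cons _ _ p) = colourAt-last p

      colourAt-satisfies : (p : Schedule P c ℓ) (i : Fin (suc ℓ)) → P (colourAt p i)
      colourAt-satisfies p F.zero = head-satisfies p
      colourAt-satisfies (cons _ _ p) (F.suc i) = colourAt-satisfies p i

      colourAt-step : (p : Schedule P c ℓ) (i : Fin ℓ) →
        RestrictedStep (colourAt p (inject₁ i)) (colourAt p (F.suc i))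
      colourAt-step (cons _ st p) F.zero = st
      colourAt-step (cons _ _ p) (F.suc i) = colourAt-step p i

OffDiagonal : ∀ {K} → List (Fin K × Fin K) → Set
OffDiagonal ps = ∀ {a b} → (a , b) ∈ ps → a ≢ b

module _ {n K : ℕ} where

  MixOf : Coloring n K → Coloring n K → Coloring n K → Set
  MixOf o T m = ∀ v → m v ≡ o v ⊎ m v ≡ T v

  moved-or-kept : ∀ {o T m} → MixOf o T m → ∀ v → m v ≡ o v ⊎ (o v ≢ T v × m v ≡ T v)
  moved-or-kept {o} {T} mix v with mix v | o v FP.≟ T v
  ... | inj₁ m≡o | _ = inj₁ m≡o
  ... | inj₂ m≡T | yes o≡T = inj₁ (trans m≡T (sym o≡T))
  ... | inj₂ m≡T | no o≢T = inj₂ (o≢T , m≡T)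

  -- The pair (a , b) recolours at once every vertex that is a in o and b in T.
  recolour-along : (o T : Coloring n K) (ps : List (Fin K × Fin K)) → OffDiagonal ps →
    (∀ v → o v ≢ T v → (o v , T v) ∈ ps) →
    Σ (Schedule (MixOf o T) o (length ps)) λ p → ∀ v → last p v ≡ T v
  recolour-along o T [] _ covers = nil (λ _ → inj₁ refl) , o≗T
    where
      o≗T : ∀ v → o v ≡ T v
      o≗T v with o v FP.≟ T v
      ... | yes o≡T = o≡T
      ... | no o≢T with () ← covers v o≢T
  recolour-along o T ((a , b) ∷ ps) off covers =
    cons (λ _ → inj₁ refl) step (mapₛ widen (proj₁ rest)) ,
    λ v → trans (cong (λ c → c v) (last-mapₛ widen (proj₁ rest))) (proj₂ rest v)
    where
      moves? : ∀ v → Dec (o v ≡ a × T v ≡ b)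
      moves? v = (o v FP.≟ a) ×-dec (T v FP.≟ b)

      o₁ : Coloring n K
      o₁ = override moves? T o

      o₁-moving : ∀ v → o v ≡ a × T v ≡ b → o₁ v ≡ T v
      o₁-moving v = override-yes moves? T o

      o₁-moved : ∀ v → o v ≢ o₁ v → (o v ≡ a × T v ≡ b) × o₁ v ≡ T v
      o₁-moved v o≢o₁ = moves , o₁-moving v moves
        where moves = override-changed moves? T o o≢o₁

      o₁-mix : MixOf o T o₁
      o₁-mix v with o v FP.≟ o₁ v
      ... | yes o≡o₁ = inj₁ (sym o≡o₁)
      ... | no o≢o₁ = inj₂ (proj₂ (o₁-moved v o≢o₁))

      step : RestrictedStep o o₁
      step = a , b , off (here refl) , λ v o≢o₁ →
        let ((o≡a , T≡b) , o₁≡T) = o₁-moved v o≢o₁ in o≡a , trans o₁≡T T≡b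

      covers₁ : ∀ v → o₁ v ≢ T v → (o₁ v , T v) ∈ ps
      covers₁ v o₁≢T with o v FP.≟ o₁ v
      ... | no o≢o₁ = ⊥-elim (o₁≢T (proj₂ (o₁-moved v o≢o₁)))
      ... | yes o≡o₁ with covers v (subst (_≢ T v) (sym o≡o₁) o₁≢T)
      ...   | here refl = ⊥-elim (o₁≢T (o₁-moving v (refl , refl)))
      ...   | there m = subst (λ x → (x , T v) ∈ ps) o≡o₁ m

      widen : ∀ {m} → MixOf o₁ T m → MixOf o T m
      widen mix v with mix v
      ... | inj₂ m≡T = inj₂ m≡T
      ... | inj₁ m≡o₁ with o₁-mix v
      ...   | inj₁ o₁≡o = inj₁ (trans m≡o₁ o₁≡o)
      ...   | inj₂ o₁≡T = inj₂ (trans m≡o₁ o₁≡T)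

      rest = recolour-along o₁ T ps (λ m → off (there m)) covers₁

length-cartesianProductWith : {A B C : Set} (f : A → B → C) (xs : List A) (ys : List B) →
  length (cartesianProductWith f xs ys) ≡ length xs * length ys
length-cartesianProductWith f [] ys = refl
length-cartesianProductWith f (x ∷ xs) ys =
  trans (LP.length-++ (map (f x) ys))
        (cong₂ _+_ (LP.length-map (f x) ys) (length-cartesianProductWith f xs ys))

module _ {k : ℕ} where

  movesFrom : List (Fin (suc k)) → List (Fin (suc k) × Fin (suc k))
  movesFrom as = cartesianProductWith (λ a j → a , punchIn a j) as (allFin k)

  length-movesFrom : ∀ as → length (movesFrom as) ≡ length as * k
  length-movesFrom as = trans (length-cartesianProductWith _ as (allFin k))
                              (cong (length as *_) (LP.length-tabulate {n = k} (λ j → j)))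

  movesFrom-offDiagonal : ∀ as → OffDiagonal (movesFrom as)
  movesFrom-offDiagonal as ab∈ with MP.∈-cartesianProductWith⁻ _ as (allFin k) ab∈
  ... | a , j , _ , _ , refl = λ a≡punchIn → FP.punchInᵢ≢i a j (sym a≡punchIn)

  ∈-movesFrom : ∀ {as a b} → a ∈ as → b ≢ a → (a , b) ∈ movesFrom as
  ∈-movesFrom {as} {a} a∈as b≢a =
    subst (λ x → (a , x) ∈ movesFrom as) (FP.punchIn-punchOut (λ a≡b → b≢a (sym a≡b)))
      (MP.∈-cartesianProductWith⁺ (λ a j → a , punchIn a j) a∈as (MP.∈-allFin _))

module Recolouring {n d k t : ℕ} (G : Graph n) (d+2≤K : d + 2 ≤ suc k)
  (ord : Fin n ↔ Fin n) (ord-degenerate : IsDegeneracyOrdering d G ord)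
  (block : Fin n → Fin t) (block-mono : ∀ i j → i F.≤ j → block i F.≤ block j)
  (block-independent : ∀ i j → block i ≡ block j →
                       adj G (Inverse.to ord i) (Inverse.to ord j) ≡ false)
  (η : Coloring n (suc k)) (η-proper : Proper G η) where

  open Inverse ord using (to; from; strictlyInverseˡ)

  K : ℕ
  K = suc k

  Col : Set
  Col = Coloring n K

  β : Fin n → ℕ
  β v = toℕ (block (from v))

  adj-sym : ∀ {u v} → adj G u v ≡ true → adj G v u ≡ true
  adj-sym {u} {v} uv = trans (symm G v u) uv

  adjacent⇒different-blocks : ∀ {u v} → adj G u v ≡ true → β u ≢ β v
  adjacent⇒different-blocks {u} {v} uv βu≡βv
    with () ← trans (sym uv)
                    (trans (sym (cong₂ (adj G) (strictlyInverseˡ u) (strictlyInverseˡ v)))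
                           (block-independent (from u) (from v) (FP.toℕ-injective βu≡βv)))

  later-block⇒later-position : ∀ {u v} → β u < β v → from u F.< from v
  later-block⇒later-position {u} {v} βu<βv with from u F.<? from v
  ... | yes earlier = earlier
  ... | no ¬earlier = ⊥-elim (ℕP.<⇒≱ βu<βv (block-mono (from v) (from u) (ℕP.≮⇒≥ ¬earlier)))

  laterNeighbour : Fin n → Fin n → Bool
  laterNeighbour i j = does (i F.<? j) ∧ adj G (to i) (to j)

  fresh-exists : (c : Col) (b : Fin K) (v : Fin n) →
    ∃ λ x → x ≢ b × (∀ j → laterNeighbour (from v) j ≡ true → c (to j) ≢ x)
  fresh-exists c b v = fresh-colour (laterNeighbour (from v)) (λ j → c (to j)) b
                                    (ord-degenerate (from v)) d+2≤K

  fresh : Col → Fin K → Fin n → Fin K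
  fresh c b v = proj₁ (fresh-exists c b v)

  fresh-≢ : ∀ c b v → fresh c b v ≢ b
  fresh-≢ c b v = proj₁ (proj₂ (fresh-exists c b v))

  fresh-avoids : ∀ c b {v u} → β v < β u → adj G v u ≡ true → c u ≢ fresh c b v
  fresh-avoids c b {v} {u} βv<βu vu =
    subst (λ w → c w ≢ fresh c b v) (strictlyInverseˡ u)
          (proj₂ (proj₂ (fresh-exists c b v)) (from u) later)
    where
      later : laterNeighbour (from v) (from u) ≡ true
      later = trans (cong₂ _∧_ (dec-true (from v F.<? from u) (later-block⇒later-position βv<βu))
                               (cong₂ (adj G) (strictlyInverseˡ v) (strictlyInverseˡ u)))
                    vu

  inBlock? : ∀ s v → Dec (β v ≡ s)
  inBlock? s v = β v ℕ.≟ s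

  ProperFrom : ℕ → Col → Set
  ProperFrom s c = ∀ u v → s ≤ β u → s ≤ β v → adj G u v ≡ true → c u ≢ c v

  AgreeOffBlock : ℕ → Col → Col → Set
  AgreeOffBlock s o c = ∀ v → β v ≢ s → o v ≡ c v

  AtTargetFrom : ℕ → Col → Set
  AtTargetFrom s c = ∀ v → s ≤ β v → c v ≡ η v

  SafeRecolouring : ℕ → Col → Col → Set
  SafeRecolouring s o T =
    (∀ v → o v ≢ T v → β v ≡ s) ×
    (∀ v u → o v ≢ T v → s < β u → adj G v u ≡ true → T v ≢ o u)

  above-block : ∀ {s v} → s ≤ β v → β v ≢ s → s < β v
  above-block s≤βv βv≢s = ℕP.≤∧≢⇒< s≤βv (λ s≡βv → βv≢s (sym s≡βv))

  neighbour-above : ∀ {s u v} → β u ≡ s → s ≤ β v → adj G u v ≡ true → s < β v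
  neighbour-above βu≡s s≤βv uv =
    above-block s≤βv (λ βv≡s → adjacent⇒different-blocks uv (trans βu≡s (sym βv≡s)))

  -- Block s is independent, so at most one end of an edge changes colour.
  mix-properFrom : ∀ {s o T m} → ProperFrom s o → SafeRecolouring s o T →
    MixOf o T m → ProperFrom s m
  mix-properFrom o-ok (in-block , compatible) mix u v s≤βu s≤βv uv
    with moved-or-kept mix u | moved-or-kept mix v
  ... | inj₁ mu≡ou | inj₁ mv≡ov = λ mu≡mv →
    o-ok u v s≤βu s≤βv uv (trans (sym mu≡ou) (trans mu≡mv mv≡ov))
  ... | inj₂ (ou≢Tu , mu≡Tu) | inj₁ mv≡ov = λ mu≡mv →
    compatible u v ou≢Tu (neighbour-above (in-block u ou≢Tu) s≤βv uv) uv
               (trans (sym mu≡Tu) (trans mu≡mv mv≡ov))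
  ... | inj₁ mu≡ou | inj₂ (ov≢Tv , mv≡Tv) = λ mu≡mv →
    compatible v u ov≢Tv (neighbour-above (in-block v ov≢Tv) s≤βu (adj-sym uv)) (adj-sym uv)
               (trans (sym mv≡Tv) (trans (sym mu≡mv) mu≡ou))
  ... | inj₂ (ou≢Tu , _) | inj₂ (ov≢Tv , _) =
    ⊥-elim (adjacent⇒different-blocks uv (trans (in-block u ou≢Tu) (sym (in-block v ov≢Tv))))

  recolour-block : ∀ {s o ℓ} (T : Col) (ps : List (Fin K × Fin K)) → length ps ≡ ℓ →
    ProperFrom s o → SafeRecolouring s o T →
    OffDiagonal ps → (∀ v → o v ≢ T v → (o v , T v) ∈ ps) →
    Σ (Schedule (ProperFrom s) o ℓ) λ p → ∀ v → last p v ≡ T v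
  recolour-block {o = o} T ps |ps|≡ℓ o-ok safe off covers =
    cast |ps|≡ℓ (mapₛ (mix-properFrom o-ok safe) p) ,
    λ v → trans (cong (λ c → c v) (trans (last-cast |ps|≡ℓ _) (last-mapₛ _ p))) (p≗T v)
    where open Σ (recolour-along o T ps off covers) renaming (proj₁ to p; proj₂ to p≗T)

  finish : ∀ {s o c} → ProperFrom s o → AgreeOffBlock s o c → AtTargetFrom (suc s) c →
    Σ (Schedule (ProperFrom s) o (K * k)) λ p → AtTargetFrom s (last p)
  finish {s} {o} {c} o-ok o≈c c-done = p , done
    where
      T : Col
      T = override (inBlock? s) η o

      safe : SafeRecolouring s o T
      safe = (λ v o≢T → override-changed (inBlock? s) η o o≢T) ,
             λ v u o≢T s<βu vu T≡ou → η-proper v u vu (begin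
               η v ≡⟨ override-yes (inBlock? s) η o (override-changed (inBlock? s) η o o≢T) ⟨
               T v ≡⟨ T≡ou ⟩
               o u ≡⟨ o≈c u (ℕP.>⇒≢ s<βu) ⟩
               c u ≡⟨ c-done u s<βu ⟩
               η u ∎)
        where open ≡-Reasoning

      |allMoves| : length (movesFrom (allFin K)) ≡ K * k
      |allMoves| = trans (length-movesFrom (allFin K))
                         (cong (_* k) (LP.length-tabulate {n = K} (λ j → j)))

      covers : ∀ v → o v ≢ T v → (o v , T v) ∈ movesFrom (allFin K)
      covers v o≢T = ∈-movesFrom (MP.∈-allFin (o v)) (λ T≡o → o≢T (sym T≡o))

      open Σ (recolour-block T (movesFrom (allFin K)) |allMoves|
                             o-ok safe (movesFrom-offDiagonal (allFin K)) covers)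
        renaming (proj₁ to p; proj₂ to p≗T)

      done : AtTargetFrom s (last p)
      done v s≤βv with inBlock? s v
      ... | yes βv≡s = trans (p≗T v) (override-yes (inBlock? s) η o βv≡s)
      ... | no βv≢s = begin
        last p v ≡⟨ p≗T v ⟩
        T v      ≡⟨ override-no (inBlock? s) η o βv≢s ⟩
        o v      ≡⟨ o≈c v βv≢s ⟩
        c v      ≡⟨ c-done v (above-block s≤βv βv≢s) ⟩
        η v      ∎
        where open ≡-Reasoning

  vacate : ∀ {s o c} (b : Fin K) → ProperFrom s o → AgreeOffBlock s o c →
    Σ (Schedule (ProperFrom s) o k) λ p →
      AgreeOffBlock s (last p) c × (∀ v → β v ≡ s → last p v ≢ b)
  vacate {s} {o} {c} b o-ok o≈c = p , agree , avoids
    where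
      clashes? : ∀ v → Dec (β v ≡ s × o v ≡ b)
      clashes? v = (β v ℕ.≟ s) ×-dec (o v FP.≟ b)

      T : Col
      T = override clashes? (fresh c b) o

      T-moved : ∀ v → o v ≢ T v → (β v ≡ s × o v ≡ b) × T v ≡ fresh c b v
      T-moved v o≢T = clash , override-yes clashes? (fresh c b) o clash
        where clash = override-changed clashes? (fresh c b) o o≢T

      T-off : ∀ v → β v ≢ s → T v ≡ o v
      T-off v βv≢s = override-no clashes? (fresh c b) o (λ clash → βv≢s (proj₁ clash))

      T-≢b : ∀ v → β v ≡ s → T v ≢ b
      T-≢b v βv≡s = by-cases (o v FP.≟ b)
        where
          by-cases : Dec (o v ≡ b) → T v ≢ b
          by-cases (yes o≡b) T≡b =
            fresh-≢ c b v (trans (sym (override-yes clashes? (fresh c b) o (βv≡s , o≡b))) T≡b)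
          by-cases (no o≢b) T≡b =
            o≢b (trans (sym (override-no clashes? (fresh c b) o (λ clash → o≢b (proj₂ clash)))) T≡b)

      safe : SafeRecolouring s o T
      safe = (λ v o≢T → proj₁ (proj₁ (T-moved v o≢T))) ,
             λ v u o≢T s<βu vu T≡ou →
               let ((βv≡s , _) , T≡fresh) = T-moved v o≢T in
               fresh-avoids c b (subst (_< β u) (sym βv≡s) s<βu) vu
                 (trans (sym (o≈c u (ℕP.>⇒≢ s<βu))) (trans (sym T≡ou) T≡fresh))

      covers : ∀ v → o v ≢ T v → (o v , T v) ∈ movesFrom [ b ]
      covers v o≢T = ∈-movesFrom {as = [ b ]} (here (proj₂ (proj₁ (T-moved v o≢T))))
                                 (λ T≡o → o≢T (sym T≡o))

      open Σ (recolour-block T (movesFrom [ b ]) (trans (length-movesFrom [ b ]) (ℕP.+-identityʳ k))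
                             o-ok safe (movesFrom-offDiagonal [ b ]) covers)
        renaming (proj₁ to p; proj₂ to p≗T)

      agree : AgreeOffBlock s (last p) c
      agree v βv≢s = trans (p≗T v) (trans (T-off v βv≢s) (o≈c v βv≢s))

      avoids : ∀ v → β v ≡ s → last p v ≢ b
      avoids v βv≡s = subst (_≢ b) (sym (p≗T v)) (T-≢b v βv≡s)

  follow-step : ∀ {s o c c' a b} → ProperFrom s o → AgreeOffBlock s o c →
    (∀ v → β v ≡ s → o v ≢ b) → ProperFrom (suc s) c' →
    a ≢ b → (∀ v → c v ≢ c' v → c v ≡ a × c' v ≡ b) →
    Σ Col λ o' → ProperFrom s o' × RestrictedStep o o' × AgreeOffBlock s o' c'
  follow-step {s} {o} {c} {c'} {a} {b} o-ok o≈c no-b c'-ok a≢b moves =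
    o' , o'-ok , (a , b , a≢b , step) , o'≈c'
    where
      o' : Col
      o' = override (inBlock? s) o c'

      o'-in : ∀ v → β v ≡ s → o' v ≡ o v
      o'-in v = override-yes (inBlock? s) o c'

      o'≈c' : AgreeOffBlock s o' c'
      o'≈c' v = override-no (inBlock? s) o c'

      c'-kept-or-b : ∀ v → c' v ≡ c v ⊎ c' v ≡ b
      c'-kept-or-b v with c v FP.≟ c' v
      ... | yes c≡c' = inj₁ (sym c≡c')
      ... | no c≢c' = inj₂ (proj₂ (moves v c≢c'))

      step : ∀ v → o v ≢ o' v → o v ≡ a × o' v ≡ b
      step v o≢o' with inBlock? s v
      ... | yes βv≡s = ⊥-elim (o≢o' (sym (o'-in v βv≡s)))
      ... | no βv≢s = trans (o≈c v βv≢s) (proj₁ moved) , trans (o'≈c' v βv≢s) (proj₂ moved)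
        where
          moved = moves v λ c≡c' → o≢o' (trans (o≈c v βv≢s) (trans c≡c' (sym (o'≈c' v βv≢s))))

      block-vs-above : ∀ u v → β u ≡ s → s < β v → adj G u v ≡ true → o' u ≢ o' v
      block-vs-above u v βu≡s s<βv uv o'u≡o'v with c'-kept-or-b v
      ... | inj₁ c'≡c = o-ok u v (ℕP.≤-reflexive (sym βu≡s)) (ℕP.<⇒≤ s<βv) uv (begin
        o u  ≡⟨ o'-in u βu≡s ⟨
        o' u ≡⟨ o'u≡o'v ⟩
        o' v ≡⟨ o'≈c' v (ℕP.>⇒≢ s<βv) ⟩
        c' v ≡⟨ c'≡c ⟩
        c v  ≡⟨ o≈c v (ℕP.>⇒≢ s<βv) ⟨
        o v  ∎)
        where open ≡-Reasoning
      ... | inj₂ c'≡b = no-b u βu≡s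
        (trans (sym (o'-in u βu≡s)) (trans o'u≡o'v (trans (o'≈c' v (ℕP.>⇒≢ s<βv)) c'≡b)))

      o'-ok : ProperFrom s o'
      o'-ok u v s≤βu s≤βv uv with inBlock? s u | inBlock? s v
      ... | yes βu≡s | yes βv≡s = ⊥-elim (adjacent⇒different-blocks uv (trans βu≡s (sym βv≡s)))
      ... | yes βu≡s | no βv≢s = block-vs-above u v βu≡s (above-block s≤βv βv≢s) uv
      ... | no βu≢s | yes βv≡s = λ o'u≡o'v →
        block-vs-above v u βv≡s (above-block s≤βu βu≢s) (adj-sym uv) (sym o'u≡o'v)
      ... | no βu≢s | no βv≢s = λ o'u≡o'v →
        c'-ok u v (above-block s≤βu βu≢s) (above-block s≤βv βv≢s) uv
              (trans (sym (o'≈c' u βu≢s)) (trans o'u≡o'v (o'≈c' v βv≢s)))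

  advance : ∀ {s o c c'} → ProperFrom s o → AgreeOffBlock s o c → RestrictedStep c c' →
    ProperFrom (suc s) c' → Σ (Schedule (ProperFrom s) o K) λ p → AgreeOffBlock s (last p) c'
  advance {s} o-ok o≈c (a , b , a≢b , moves) c'-ok =
    let p , p≈c , p-no-b = vacate b o-ok o≈c
        o' , o'-ok , step , o'≈c' = follow-step (last-satisfies p) p≈c p-no-b c'-ok a≢b moves
        p⁺ = p ++ cons (last-satisfies p) step (nil o'-ok)
    in cast (ℕP.+-comm k 1) p⁺ ,
       λ v βv≢s → trans (cong (λ c → c v) (trans (last-cast (ℕP.+-comm k 1) p⁺) (last-++ p _)))
                        (o'≈c' v βv≢s)

  lift : ∀ {s c o ℓ} (q : Schedule (ProperFrom (suc s)) c ℓ) → AtTargetFrom (suc s) (last q) →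
    ProperFrom s o → AgreeOffBlock s o c →
    Σ ℕ λ ℓ' → ℓ' + K ≡ (ℓ + K) * K ×
      Σ (Schedule (ProperFrom s) o ℓ') λ p → AtTargetFrom s (last p)
  lift (nil _) c-done o-ok o≈c =
    K * k , trans (ℕP.+-comm (K * k) K) (sym (ℕP.*-suc K k)) , finish o-ok o≈c c-done
  lift {s} (cons _ st q) q-done o-ok o≈c =
    let p , p≈c' = advance o-ok o≈c st (head-satisfies q)
        m , m-eq , r , r-done = lift q q-done (last-satisfies p) p≈c'
    in K + m , trans (ℕP.+-assoc K m K) (cong (K +_) m-eq) ,
       p ++ r , subst (AtTargetFrom s) (sym (last-++ p r)) r-done

  recolour-from : ∀ r s → r + s ≡ t → (σ : Col) → Proper G σ →
    Σ ℕ λ ℓ → ℓ + K ≡ K ^ suc r ×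
      Σ (Schedule (ProperFrom s) σ ℓ) λ p → AtTargetFrom s (last p)
  recolour-from zero s s≡t σ σ-proper =
    0 , sym (ℕP.*-identityʳ K) , nil (λ u v _ _ → σ-proper u v) ,
    λ v s≤βv → ⊥-elim (ℕP.<⇒≱ (FP.toℕ<n (block (from v))) (subst (_≤ β v) s≡t s≤βv))
  recolour-from (suc r) s r+s≡t σ σ-proper =
    let ℓ , ℓ-eq , q , q-done = recolour-from r (suc s) (trans (ℕP.+-suc r s) r+s≡t) σ σ-proper
        ℓ' , ℓ'-eq , p , p-done = lift q q-done (λ u v _ _ → σ-proper u v) (λ _ _ → refl)
    in ℓ' , trans ℓ'-eq (trans (cong (_* K) ℓ-eq) (ℕP.*-comm (K ^ suc r) K)) , p , p-done

  restricted-schedule : (σ : Col) → Proper G σ →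
    Σ ℕ λ ℓ → ℓ ≤ K ^ (t + 1) × RestrictedSchedule G σ η ℓ
  restricted-schedule σ σ-proper =
    let ℓ , ℓ-eq , p , p-done = recolour-from t 0 (ℕP.+-identityʳ t) σ σ-proper
    in ℓ ,
       ℕP.≤-trans (ℕP.m≤m+n ℓ K) (ℕP.≤-reflexive (trans ℓ-eq (cong (K ^_) (ℕP.+-comm 1 t)))) ,
       toRestrictedSchedule G (λ c-ok u v → c-ok u v z≤n z≤n) p (λ v → p-done v z≤n)

lemma6 : ∀ {n} (G : Graph n) (d k t : ℕ) → Degenerate d G → d + 2 ≤ k →
    (σ η : Coloring n k) → Proper G σ → Proper G η →
    (ord : Fin n ↔ Fin n) → IsDegeneracyOrdering d G ord → IsConcatOfIndependentSets G ord t →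
    Σ ℕ λ ℓ → ℓ ≤ k ^ (t + 1) × RestrictedSchedule G σ η ℓ
lemma6 G d zero t _ d+2≤0 _ _ _ _ _ _ _ with () ← ℕP.m+n≤o⇒n≤o d d+2≤0
lemma6 G d (suc k) t _ d+2≤K σ η σ-proper η-proper ord ord-degenerate (block , mono , independent) =
  Recolouring.restricted-schedule G d+2≤K ord ord-degenerate block mono independent η η-proper
    σ σ-proper
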